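{- Let $n\ge 7$, let $\mathbf{S}=(1,2,\dots,n)$ be the standard cyclic order on $[n]$, and let $\mathbf{T}$ be another cyclic order on $[n]$, distinct from $\mathbf{S}$, all of whose steps $s_i$ are equal to $1$ or $3$. Then $\mathbf{S}$ and $\mathbf{T}$ are $4$-interlaced or $6$-interlaced.
   Context: Cyclic orders on $[n]$ are nondegenerate ordered set partitions $(j_1,\dots,j_n)$ (all blocks singletons), considered up to cyclic shift. Steps: $s_i=j_{i+1}-j_i\bmod n$ for $i<n$, $s_n=j_1-j_n\bmod n$. For $I\subseteq[n]$, the restriction $\mathbf{S}|_I$ keeps only the elements of $I$ in the same cyclic order. $\mathbf{S},\mathbf{T}$ are $4$-interlaced if there are distinct $a,b,c,d$ with $\mathbf{S}|_{\{a,b,c,d\}}=(a,b,c,d)$ and $\mathbf{T}|_{\{a,b,c,d\}}=(c,b,a,d)$; they are $6$-interlaced if there are distinct $a,b,c,d,e,f$ with $\mathbf{S}|_{\{a,\dots,f\}}=(a,b,c,d,e,f)$ and $\mathbf{T}|_{\{a,\dots,f\}}$ equal to $(c,d,a,b,e,f)$ or to $(a,d,e,b,c,f)$ (equalities up to cyclic shift). -}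

module Defs where

open import Data.Nat using (ℕ; zero; suc; _+_; _∸_; _<_; _≤_)
open import Data.Nat.DivMod using (_%_; m%n<n)
open import Data.Fin using (Fin; toℕ; fromℕ<)
open import Data.Fin.Properties using ()

open import Data.List using (List; []; _∷_; _++_; take; drop; tabulate)
open import Data.List.Relation.Binary.Sublist.Propositional using (_⊆_)
open import Data.Product using (Σ; ∃; _×_; _,_)
open import Data.Sum using (_⊎_)
open import Function.Definitions using (Injective)
open import Relation.Binary.PropositionalEquality using (_≡_; _≢_)
open import Relation.Nullary using (¬_)

-- The ground set [n] is modelled as Fin n = {0,…,n-1} (labels shifted by one;
-- this relabelling x ↦ x-1 preserves steps mod n and the standard order).

-- A cyclic order on [n]: a sequence (j_0,…,j_{n-1}) listing every element
-- exactly once (injective map Fin n → Fin n), considered up to cyclic shift.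
record CyclicOrder (n : ℕ) : Set where
  constructor mkCO
  field
    seq : Fin n → Fin n
    inj : Injective _≡_ _≡_ seq
open CyclicOrder public

next : {n : ℕ} → Fin n → Fin n
next {suc n} i = fromℕ< (m%n<n (suc (toℕ i)) (suc n))

shift : {n : ℕ} → ℕ → Fin n → Fin n
shift {suc n} k i = fromℕ< (m%n<n (toℕ i + k) (suc n))

_≈c_ : {n : ℕ} → CyclicOrder n → CyclicOrder n → Set
_≈c_ {n} S T = Σ ℕ λ k → ∀ i → seq T i ≡ seq S (shift k i)

standard : (n : ℕ) → CyclicOrder n
standard n = mkCO (λ i → i) (λ eq → eq)

step : {n : ℕ} → CyclicOrder n → Fin n → ℕ
step {zero} S ()
step {suc n} S i = (toℕ (seq S (next i)) + suc n ∸ toℕ (seq S i)) % suc n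

toList : {n : ℕ} → CyclicOrder n → List (Fin n)
toList S = tabulate (seq S)

rotate : {A : Set} → ℕ → List A → List A
rotate r xs = drop r xs ++ take r xs

-- S|_{set of xs} = (x_1,…,x_k) up to cyclic shift (xs assumed distinct):
-- some cyclic rotation of xs occurs as a subsequence of the sequence of S
-- (the restriction of a linear representative to a subset is its subsequence).
Restricts : {n : ℕ} → CyclicOrder n → List (Fin n) → Set
Restricts S xs = Σ ℕ λ r → r < Data.List.length xs × rotate r xs ⊆ toList S

Distinct : {A : Set} → List A → Set
Distinct {A} = Data.List.Relation.Unary.AllPairs.AllPairs {A = A} _≢_
  where import Data.List.Relation.Unary.AllPairs

FourInterlaced : {n : ℕ} → CyclicOrder n → CyclicOrder n → Set
FourInterlaced {n} S T =
  Σ (Fin n) λ a → Σ (Fin n) λ b → Σ (Fin n) λ c → Σ (Fin n) λ d →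
    Distinct (a ∷ b ∷ c ∷ d ∷ []) ×
    Restricts S (a ∷ b ∷ c ∷ d ∷ []) ×
    Restricts T (c ∷ b ∷ a ∷ d ∷ [])

SixInterlaced : {n : ℕ} → CyclicOrder n → CyclicOrder n → Set
SixInterlaced {n} S T =
  Σ (Fin n) λ a → Σ (Fin n) λ b → Σ (Fin n) λ c →
  Σ (Fin n) λ d → Σ (Fin n) λ e → Σ (Fin n) λ f →
    Distinct (a ∷ b ∷ c ∷ d ∷ e ∷ f ∷ []) ×
    Restricts S (a ∷ b ∷ c ∷ d ∷ e ∷ f ∷ []) ×
    (Restricts T (c ∷ d ∷ a ∷ b ∷ e ∷ f ∷ []) ⊎
     Restricts T (a ∷ d ∷ e ∷ b ∷ c ∷ f ∷ []))

-- Write t i for the value of T at position i and s i for its step, all modulo N. If s i = 3, the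
-- value t i + 2 is again followed by a step 3, since a step 1 from it would reach t i + 3 = t (i + 1)
-- a second time; and t i − 2 is followed by a step 3, since t i + 1 can only be reached from it.
-- So the values carrying a step 3 are invariant under ± 2, and as two consecutive steps add up to an
-- even number, s has period 2. Hence T has all steps 1 (it is the standard order), all steps 3, or
-- alternating steps 1, 3, and in the last two cases t is affine along the positions. Injectivity of
-- t rules out 3 ∣ N, resp. forces N ≡ 2 (mod 4), and in the surviving cases the interlacing
-- witnesses are read off from the explicit values of t.

module Submission where

open import Defs

open import Data.Empty using (⊥-elim)
open import Data.Fin using (Fin; toℕ; zero; suc; punchOut)
open import Data.Fin.Properties
  using (toℕ-fromℕ<; toℕ-injective; toℕ<n; any?; all?; ¬∀⟶∃¬; punchOut-injective; injective⇒≤)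
  renaming (_≟_ to _≟ᶠ_)
open import Data.List as List using (List; []; _∷_; _++_; [_]; map; length; tabulate; take; drop)
open import Data.List.Properties using (++-identityʳ; length-++; map-∘; map-cong)
open import Data.List.Relation.Binary.Pointwise using (Pointwise-≡⇒≡; []; _∷_)
open import Data.List.Relation.Binary.Sublist.Propositional using (_⊆_; []; _∷_; _∷ʳ_; minimum)
open import Data.List.Relation.Binary.Sublist.Propositional.Properties using (++⁺; ++⁺ˡ)
open import Data.List.Relation.Unary.All as All using (All; []; _∷_)
import Data.List.Relation.Unary.All.Properties as All
open import Data.List.Relation.Unary.AllPairs as AllPairs using (AllPairs; []; _∷_)
import Data.List.Relation.Unary.AllPairs.Properties as AllPairs
open import Data.List.Relation.Unary.Linked using (Linked; []; [-]; _∷_)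
open import Data.List.Relation.Unary.Linked.Properties using (Linked⇒AllPairs)
open import Data.Nat using (ℕ; zero; suc; _+_; _*_; _∸_; _≤_; _<_; z≤n; s≤s; _≟_; _<?_; _≤?_; NonZero)
open import Data.Nat.Divisibility using (_∣_; divides)
open import Data.Nat.DivMod
  using (_%_; m%n<n; [m+kn]%n≡m%n; [m+n]%n≡m%n; m<n⇒m%n≡m; %-distribˡ-+; m%n%n≡m%n; _divMod_; result)
open import Data.Nat.Properties
open import Data.Nat.Tactic.RingSolver using (solve-∀; solve)
open import Data.Product using (Σ; ∃₂; _×_; _,_; proj₁; proj₂)
open import Data.Sum using (_⊎_; inj₁; inj₂)
open import Function.Definitions using (Injective)
open import Relation.Binary.PropositionalEquality
  using (_≡_; _≢_; refl; sym; trans; cong; cong₂; subst; module ≡-Reasoning)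
open import Relation.Nullary using (¬_; yes; no)
open import Relation.Nullary.Decidable using (True; toWitness)
module _ {n : ℕ} where

  toℕ-shift : ∀ a (x : Fin (suc n)) → toℕ (shift a x) ≡ (toℕ x + a) % suc n
  toℕ-shift a x = toℕ-fromℕ< (m%n<n (toℕ x + a) (suc n))

  shift-cong : ∀ {a b} (x y : Fin (suc n)) → (toℕ x + a) % suc n ≡ (toℕ y + b) % suc n → shift a x ≡ shift b y
  shift-cong {a} {b} x y e = toℕ-injective (trans (toℕ-shift a x) (trans e (sym (toℕ-shift b y))))

  shift-identity : ∀ (x : Fin (suc n)) → shift 0 x ≡ x
  shift-identity x = toℕ-injective (begin
    toℕ (shift 0 x)       ≡⟨ toℕ-shift 0 x ⟩
    (toℕ x + 0) % suc n   ≡⟨ cong (_% suc n) (+-identityʳ (toℕ x)) ⟩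
    toℕ x % suc n         ≡⟨ m<n⇒m%n≡m (toℕ<n x) ⟩
    toℕ x                 ∎)
    where open ≡-Reasoning

  shift-+ : ∀ a b (x : Fin (suc n)) → shift a (shift b x) ≡ shift (b + a) x
  shift-+ a b x = shift-cong (shift b x) x (begin
    (toℕ (shift b x) + a) % suc n               ≡⟨ cong (λ m → (m + a) % suc n) (toℕ-shift b x) ⟩
    ((toℕ x + b) % suc n + a) % suc n           ≡⟨ %-distribˡ-+ ((toℕ x + b) % suc n) a (suc n) ⟩
    ((toℕ x + b) % suc n % suc n + a % suc n) % suc n
                                                ≡⟨ cong (λ m → (m + a % suc n) % suc n) (m%n%n≡m%n (toℕ x + b) (suc n)) ⟩
    ((toℕ x + b) % suc n + a % suc n) % suc n   ≡⟨ %-distribˡ-+ (toℕ x + b) a (suc n) ⟨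
    (toℕ x + b + a) % suc n                     ≡⟨ cong (_% suc n) (+-assoc (toℕ x) b a) ⟩
    (toℕ x + (b + a)) % suc n                   ∎)
    where open ≡-Reasoning

  shift-comm : ∀ a b (x : Fin (suc n)) → shift a (shift b x) ≡ shift b (shift a x)
  shift-comm a b x = trans (shift-+ a b x) (trans (cong (λ c → shift c x) (+-comm b a)) (sym (shift-+ b a x)))

  shift-mod : ∀ {a b} k l (x : Fin (suc n)) → a + k * suc n ≡ b + l * suc n → shift a x ≡ shift b x
  shift-mod {a} {b} k l x e = shift-cong x x (begin
    (toℕ x + a) % suc n               ≡⟨ [m+kn]%n≡m%n (toℕ x + a) k (suc n) ⟨
    (toℕ x + a + k * suc n) % suc n   ≡⟨ cong (_% suc n) (trans (+-assoc (toℕ x) a _) (trans (cong (toℕ x +_) e) (sym (+-assoc (toℕ x) b _)))) ⟩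
    (toℕ x + b + l * suc n) % suc n   ≡⟨ [m+kn]%n≡m%n (toℕ x + b) l (suc n) ⟩
    (toℕ x + b) % suc n               ∎)
    where open ≡-Reasoning

  -- shift (a * n) undoes shift a, as a * n ≡ - a modulo n + 1.
  shift-inverse : ∀ a (x : Fin (suc n)) → shift (a * n) (shift a x) ≡ x
  shift-inverse a x = begin
    shift (a * n) (shift a x)  ≡⟨ shift-+ (a * n) a x ⟩
    shift (a + a * n) x        ≡⟨ shift-mod 0 a x (trans (+-identityʳ _) (sym (*-suc a n))) ⟩
    shift 0 x                  ≡⟨ shift-identity x ⟩
    x                          ∎
    where open ≡-Reasoning

  shift-injective : ∀ a {x y : Fin (suc n)} → shift a x ≡ shift a y → x ≡ y
  shift-injective a {x} {y} e =
    trans (sym (shift-inverse a x)) (trans (cong (shift (a * n)) e) (shift-inverse a y))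

  shift-toℕ : ∀ (x : Fin (suc n)) → shift (toℕ x) zero ≡ x
  shift-toℕ x = toℕ-injective (trans (toℕ-shift (toℕ x) zero) (m<n⇒m%n≡m (toℕ<n x)))

  shift-injectiveˡ : ∀ {a b} (x : Fin (suc n)) → a < suc n → b < suc n → shift a x ≡ shift b x → a ≡ b
  shift-injectiveˡ {a} {b} x a<N b<N e = begin
    a                   ≡⟨ m<n⇒m%n≡m a<N ⟨
    a % suc n           ≡⟨ toℕ-shift a zero ⟨
    toℕ (shift a zero)  ≡⟨ cong toℕ (shift-injective (toℕ x) (begin
        shift (toℕ x) (shift a zero)  ≡⟨ shift-comm (toℕ x) a zero ⟩
        shift a (shift (toℕ x) zero)  ≡⟨ cong (shift a) (shift-toℕ x) ⟩
        shift a x                     ≡⟨ e ⟩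
        shift b x                     ≡⟨ cong (shift b) (shift-toℕ x) ⟨
        shift b (shift (toℕ x) zero)  ≡⟨ shift-comm b (toℕ x) zero ⟩
        shift (toℕ x) (shift b zero)  ∎)) ⟩
    toℕ (shift b zero)  ≡⟨ toℕ-shift b zero ⟩
    b % suc n           ≡⟨ m<n⇒m%n≡m b<N ⟩
    b                   ∎
    where open ≡-Reasoning

  next-shift : ∀ (i : Fin (suc n)) → next i ≡ shift 1 i
  next-shift i = toℕ-injective (begin
    toℕ (next i)         ≡⟨ toℕ-fromℕ< (m%n<n (suc (toℕ i)) (suc n)) ⟩
    suc (toℕ i) % suc n  ≡⟨ cong (_% suc n) (+-comm 1 (toℕ i)) ⟩
    (toℕ i + 1) % suc n  ≡⟨ toℕ-shift 1 i ⟨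
    toℕ (shift 1 i)      ∎)
    where open ≡-Reasoning

  next-injective : ∀ {i j : Fin (suc n)} → next i ≡ next j → i ≡ j
  next-injective {i} {j} e = shift-injective 1 (trans (sym (next-shift i)) (trans e (next-shift j)))

  shift-suc : ∀ d (x : Fin (suc n)) → shift (suc d) x ≡ next (shift d x)
  shift-suc d x = begin
    shift (suc d) x      ≡⟨ cong (λ c → shift c x) (+-comm 1 d) ⟩
    shift (d + 1) x      ≡⟨ shift-+ 1 d x ⟨
    shift 1 (shift d x)  ≡⟨ next-shift (shift d x) ⟨
    next (shift d x)     ∎
    where open ≡-Reasoning

module _ {A : Set} where

  window : (ℕ → A) → ℕ → ℕ → List A
  window f a zero    = []
  window f a (suc k) = f a ∷ window f (suc a) k

  window-++ : ∀ (f : ℕ → A) a k l → window f a (k + l) ≡ window f a k ++ window f (a + k) l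
  window-++ f a zero    l = cong (λ b → window f b l) (sym (+-identityʳ a))
  window-++ f a (suc k) l = cong (f a ∷_) (begin
    window f (suc a) (k + l)                              ≡⟨ window-++ f (suc a) k l ⟩
    window f (suc a) k ++ window f (suc a + k) l          ≡⟨ cong (λ b → window f (suc a) k ++ window f b l) (+-suc a k) ⟨
    window f (suc a) k ++ window f (a + suc k) l          ∎)
    where open ≡-Reasoning

  window-periodic : ∀ (f : ℕ → A) p → (∀ j → f (j + p) ≡ f j) → ∀ a k → window f (a + p) k ≡ window f a k
  window-periodic f p f-periodic a zero    = refl
  window-periodic f p f-periodic a (suc k) = cong₂ _∷_ (f-periodic a) (window-periodic f p f-periodic (suc a) k)

  tabulate-window : ∀ {m} (g : Fin m → A) (f : ℕ → A) a → (∀ i → f (a + toℕ i) ≡ g i) → tabulate g ≡ window f a m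
  tabulate-window {zero}  g f a f≗g = refl
  tabulate-window {suc m} g f a f≗g = cong₂ _∷_
    (sym (trans (cong f (sym (+-identityʳ a))) (f≗g zero)))
    (tabulate-window (λ i → g (suc i)) f (suc a) (λ i → trans (cong f (sym (+-suc a (toℕ i)))) (f≗g (suc i))))

  map-⊆-window : ∀ (f : ℕ → A) {a} k {es} → AllPairs _<_ es → All (a ≤_) es → All (_< a + k) es → map f es ⊆ window f a k
  map-⊆-window f k [] _ _ = minimum _
  map-⊆-window f {a} zero (_ ∷ _) (a≤e ∷ _) (e<a+0 ∷ _) = ⊥-elim (<⇒≱ (subst (_ <_) (+-identityʳ a) e<a+0) a≤e)
  map-⊆-window f {a} (suc k) (e<es ∷ sorted) (a≤e ∷ _) es<a+1+k
    with m≤n⇒m<n∨m≡n a≤e | All.map (λ {x} → subst (x <_) (+-suc a k)) es<a+1+k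
  ... | inj₂ refl | _ ∷ es<1+a+k = refl ∷ map-⊆-window f k sorted e<es es<1+a+k
  ... | inj₁ a<e  | es<1+a+k     = f a ∷ʳ map-⊆-window f k (e<es ∷ sorted) (a<e ∷ All.map (<-trans a<e) e<es) es<1+a+k

  ⊆-++-split : ∀ (us : List A) {vs xs} → xs ⊆ us ++ vs → ∃₂ λ ys zs → xs ≡ ys ++ zs × ys ⊆ us × zs ⊆ vs
  ⊆-++-split []       xs⊆vs        = [] , _ , refl , [] , xs⊆vs
  ⊆-++-split (u ∷ us) (.u ∷ʳ xs⊆)  with ⊆-++-split us xs⊆
  ... | ys , zs , refl , ys⊆us , zs⊆vs = ys , zs , refl , u ∷ʳ ys⊆us , zs⊆vs
  ⊆-++-split (u ∷ us) (refl ∷ xs⊆) with ⊆-++-split us xs⊆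
  ... | ys , zs , refl , ys⊆us , zs⊆vs = u ∷ ys , zs , refl , refl ∷ ys⊆us , zs⊆vs

  rotate-++ : ∀ (xs ys : List A) → rotate (length xs) (xs ++ ys) ≡ ys ++ xs
  rotate-++ xs ys = cong₂ _++_ (drop-length-++ xs) (take-length-++ xs)
    where
    drop-length-++ : ∀ xs → drop (length xs) (xs ++ ys) ≡ ys
    drop-length-++ []       = refl
    drop-length-++ (x ∷ xs) = drop-length-++ xs
    take-length-++ : ∀ xs → take (length xs) (xs ++ ys) ≡ xs
    take-length-++ []       = refl
    take-length-++ (x ∷ xs) = cong (x ∷_) (take-length-++ xs)

  rotate-⊆-++ : ∀ {x : A} {xs} us vs → x ∷ xs ⊆ us ++ vs →
                Σ ℕ λ r → r < length (x ∷ xs) × rotate r (x ∷ xs) ⊆ vs ++ us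
  rotate-⊆-++ {x} {xs} us vs x∷xs⊆ with ⊆-++-split us x∷xs⊆
  ... | ys , [] , x∷xs≡ys++[] , ys⊆us , _ =
    0 , s≤s z≤n , subst (_⊆ vs ++ us) ys≡x∷xs++[] (++⁺ˡ vs ys⊆us)
    where
    ys≡x∷xs++[] : ys ≡ (x ∷ xs) ++ []
    ys≡x∷xs++[] = trans (sym (++-identityʳ ys)) (trans (sym x∷xs≡ys++[]) (sym (++-identityʳ (x ∷ xs))))
  ... | ys , z ∷ zs , x∷xs≡ys++z∷zs , ys⊆us , zs⊆vs = subst RotatesInto (sym x∷xs≡ys++z∷zs)
    (length ys , subst (length ys <_) (sym (length-++ ys)) (m<m+n (length ys) (s≤s z≤n)) ,
     subst (_⊆ vs ++ us) (sym (rotate-++ ys (z ∷ zs))) (++⁺ zs⊆vs ys⊆us))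
    where
    RotatesInto : List A → Set
    RotatesInto l = Σ ℕ λ r → r < length l × rotate r l ⊆ vs ++ us

ascending-below : ∀ {b} ds → Linked _<_ (ds ++ [ b ]) → AllPairs _<_ ds × All (_< b) ds
ascending-below ds ascending = go ds (Linked⇒AllPairs <-trans ascending)
  where
  go : ∀ {b} ds → AllPairs _<_ (ds ++ [ b ]) → AllPairs _<_ ds × All (_< b) ds
  go []       _                     = [] , []
  go (d ∷ ds) (d<ds++b ∷ ds++b-sorted) with go ds ds++b-sorted
  ... | sorted , bounded = All.++⁻ˡ ds d<ds++b ∷ sorted , All.head (All.++⁻ʳ ds d<ds++b) ∷ bounded

module _ {n : ℕ} where

  shifts-distinct : ∀ (z : Fin (suc n)) ds → Linked _<_ (ds ++ [ suc n ]) → Distinct (map (λ e → shift e z) ds)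
  shifts-distinct z ds ascending = go (ascending-below ds ascending)
    where
    go : ∀ {ds} → AllPairs _<_ ds × All (_< suc n) ds → Distinct (map (λ e → shift e z) ds)
    go {[]}     _                               = []
    go {d ∷ ds} (d<ds ∷ sorted , d<N ∷ bounded) =
      All.map⁺ (All.zipWith (λ (d<e , e<N) same → <⇒≢ d<e (shift-injectiveˡ z d<N e<N same)) (d<ds , bounded))
      ∷ go (sorted , bounded)

  -- The positions z + e wrap around at most once, so the offsets form a sublist of the window of
  -- T read from z; that window is a rotation of the sequence of T, and rotating back splits the
  -- offsets at the wrap-around.
  restricts-shifts : ∀ (T : CyclicOrder (suc n)) (z : Fin (suc n)) d ds → Linked _<_ (d ∷ ds ++ [ suc n ]) →
                     Restricts T (map (λ e → seq T (shift e z)) (d ∷ ds))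
  restricts-shifts T z d ds ascending =
    subst (λ l → Σ ℕ λ r → r < length offsets × rotate r offsets ⊆ l) (sym tabulate-split)
      (rotate-⊆-++ (window G Z (N ∸ Z)) (window G 0 Z) (subst (offsets ⊆_) window-split offsets-⊆))
    where
    N = suc n
    Z = toℕ z
    offsets = map (λ e → seq T (shift e z)) (d ∷ ds)
    G : ℕ → Fin N
    G j = seq T (shift j zero)
    Z+N∸Z : Z + (N ∸ Z) ≡ N
    Z+N∸Z = m+[n∸m]≡n (<⇒≤ (toℕ<n z))
    G-shift : ∀ e → G (Z + e) ≡ seq T (shift e z)
    G-shift e = cong (seq T) (trans (sym (shift-+ e Z zero)) (cong (shift e) (shift-toℕ z)))
    G-periodic : ∀ j → G (j + N) ≡ G j
    G-periodic j = cong (seq T) (shift-mod 0 1 zero (trans (+-identityʳ _) (cong (j +_) (sym (+-identityʳ N)))))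
    offsets-⊆ : offsets ⊆ window G Z N
    offsets-⊆ with ascending-below (d ∷ ds) ascending
    ... | sorted , bounded = subst (_⊆ window G Z N) (trans (sym (map-∘ (d ∷ ds))) (map-cong G-shift (d ∷ ds)))
      (map-⊆-window G N (AllPairs.map⁺ (AllPairs.map (+-monoʳ-< Z) sorted))
        (All.map⁺ (All.universal (m≤m+n Z) (d ∷ ds))) (All.map⁺ (All.map (+-monoʳ-< Z) bounded)))
    window-split : window G Z N ≡ window G Z (N ∸ Z) ++ window G 0 Z
    window-split = begin
      window G Z N                                      ≡⟨ cong (window G Z) (trans (+-comm (N ∸ Z) Z) Z+N∸Z) ⟨
      window G Z ((N ∸ Z) + Z)                          ≡⟨ window-++ G Z (N ∸ Z) Z ⟩
      window G Z (N ∸ Z) ++ window G (Z + (N ∸ Z)) Z    ≡⟨ cong (λ a → window G Z (N ∸ Z) ++ window G a Z) Z+N∸Z ⟩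
      window G Z (N ∸ Z) ++ window G (0 + N) Z          ≡⟨ cong (window G Z (N ∸ Z) ++_) (window-periodic G N G-periodic 0 Z) ⟩
      window G Z (N ∸ Z) ++ window G 0 Z                ∎
      where open ≡-Reasoning
    tabulate-split : tabulate (seq T) ≡ window G 0 Z ++ window G Z (N ∸ Z)
    tabulate-split = begin
      tabulate (seq T)                       ≡⟨ tabulate-window (seq T) G 0 (λ i → cong (seq T) (shift-toℕ i)) ⟩
      window G 0 N                           ≡⟨ cong (window G 0) Z+N∸Z ⟨
      window G 0 (Z + (N ∸ Z))               ≡⟨ window-++ G 0 Z (N ∸ Z) ⟩
      window G 0 Z ++ window G Z (N ∸ Z)     ∎
      where open ≡-Reasoning

injective⇒surjective : ∀ {m} {f : Fin m → Fin m} → Injective _≡_ _≡_ f → ∀ y → Σ (Fin m) λ x → f x ≡ y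
injective⇒surjective {suc m} {f} f-injective y with any? (λ x → f x ≟ᶠ y)
... | yes hit = hit
... | no miss = ⊥-elim (<-irrefl refl (injective⇒≤ {f = g} g-injective))
  where
  y≢f : ∀ x → y ≢ f x
  y≢f x y≡fx = miss (x , sym y≡fx)
  g : Fin (suc m) → Fin m
  g x = punchOut (y≢f x)
  g-injective : Injective _≡_ _≡_ g
  g-injective gx≡gx′ = f-injective (punchOut-injective (y≢f _) (y≢f _) gx≡gx′)

module _ {n : ℕ} (T : CyclicOrder (suc n)) where

  seq-next : ∀ i → seq T (next i) ≡ shift (step T i) (seq T i)
  seq-next i = toℕ-injective (sym (begin
    toℕ (shift (step T i) (seq T i))   ≡⟨ toℕ-shift (step T i) (seq T i) ⟩
    (b + (a + N ∸ b) % N) % N          ≡⟨ cong (_% N) (+-comm b _) ⟩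
    ((a + N ∸ b) % N + b) % N          ≡⟨ %-distribˡ-+ ((a + N ∸ b) % N) b N ⟩
    ((a + N ∸ b) % N % N + b % N) % N  ≡⟨ cong (λ m → (m + b % N) % N) (m%n%n≡m%n (a + N ∸ b) N) ⟩
    ((a + N ∸ b) % N + b % N) % N      ≡⟨ %-distribˡ-+ (a + N ∸ b) b N ⟨
    (a + N ∸ b + b) % N                ≡⟨ cong (_% N) (m∸n+n≡m (≤-trans (<⇒≤ (toℕ<n (seq T i))) (m≤n+m N a))) ⟩
    (a + N) % N                        ≡⟨ [m+n]%n≡m%n a N ⟩
    a % N                              ≡⟨ m<n⇒m%n≡m (toℕ<n (seq T (next i))) ⟩
    a                                  ∎))
    where
    open ≡-Reasoning
    N = suc n
    a = toℕ (seq T (next i))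
    b = toℕ (seq T i)

  seq-shift-≢ : ∀ {p} (z : Fin (suc n)) → 0 < p → p < suc n → seq T (shift p z) ≢ seq T z
  seq-shift-≢ z 0<p p<N same =
    <⇒≢ 0<p (sym (shift-injectiveˡ z p<N (s≤s z≤n) (trans (inj T same) (sym (shift-identity z)))))

  seq-shift-suc : ∀ {d c a} (x y : Fin (suc n)) → step T (shift d x) ≡ c → seq T (shift d x) ≡ shift a y →
                  seq T (shift (suc d) x) ≡ shift (a + c) y
  seq-shift-suc {d} {c} {a} x y step≡c seq≡ =
    trans (cong (seq T) (shift-suc d x)) (trans (seq-next (shift d x)) (trans (cong₂ shift step≡c seq≡) (shift-+ c a y)))

  seq-shift-constant : ∀ {c} z → (∀ d → step T (shift d z) ≡ c) → ∀ d → seq T (shift d z) ≡ shift (d * c) (seq T z)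
  seq-shift-constant z steps-c zero    = trans (cong (seq T) (shift-identity z)) (sym (shift-identity (seq T z)))
  seq-shift-constant {c} z steps-c (suc d) =
    trans (seq-shift-suc z (seq T z) (steps-c d) (seq-shift-constant z steps-c d))
          (cong (λ e → shift e (seq T z)) (+-comm (d * c) c))

  steps-one⇒≈standard : (∀ i → step T i ≡ 1) → standard (suc n) ≈c T
  steps-one⇒≈standard steps-one = toℕ v , λ i → begin
    seq T i                                   ≡⟨ cong (seq T) (shift-toℕ i) ⟨
    seq T (shift (toℕ i) zero)                ≡⟨ seq-shift-constant zero (λ d → steps-one (shift d zero)) (toℕ i) ⟩
    shift (toℕ i * 1) v                       ≡⟨ cong (λ e → shift e v) (*-identityʳ (toℕ i)) ⟩
    shift (toℕ i) v                           ≡⟨ cong (shift (toℕ i)) (shift-toℕ v) ⟨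
    shift (toℕ i) (shift (toℕ v) zero)        ≡⟨ shift-comm (toℕ i) (toℕ v) zero ⟩
    shift (toℕ v) (shift (toℕ i) zero)        ≡⟨ cong (shift (toℕ v)) (shift-toℕ i) ⟩
    shift (toℕ v) i                           ∎
    where
    open ≡-Reasoning
    v = seq T zero

  constant-step⇒∤ : ∀ {c} z → 1 < c → (∀ d → step T (shift d z) ≡ c) → ¬ c ∣ suc n
  constant-step⇒∤ {c} z 1<c steps-c (divides zero ())
  constant-step⇒∤ {c} z 1<c steps-c (divides m@(suc _) N≡m*c) =
    seq-shift-≢ z (s≤s z≤n) (subst (m <_) (sym N≡m*c) (m<m*n m c 1<c)) (begin
      seq T (shift m z)      ≡⟨ seq-shift-constant z steps-c m ⟩
      shift (m * c) v        ≡⟨ shift-mod 0 1 v (trans (+-identityʳ (m * c)) (trans (sym N≡m*c) (sym (+-identityʳ (suc n))))) ⟩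
      shift 0 v              ≡⟨ shift-identity v ⟩
      v                      ∎)
    where
    open ≡-Reasoning
    v = seq T z

module _ {n : ℕ} (T : CyclicOrder (suc n)) (w : Fin (suc n))
         (evens-one : ∀ D → step T (shift (2 * D) w) ≡ 1) (odds-three : ∀ D → step T (shift (1 + 2 * D) w) ≡ 3) where

  seq-shift-alternating : ∀ D → seq T (shift (2 * D) w) ≡ shift (4 * D) (seq T w)
                              × seq T (shift (1 + 2 * D) w) ≡ shift (1 + 4 * D) (seq T w)
  seq-shift-alternating = go
    where
    v = seq T w
    odd : ∀ D → seq T (shift (2 * D) w) ≡ shift (4 * D) v → seq T (shift (1 + 2 * D) w) ≡ shift (1 + 4 * D) v
    odd D even≡ = trans (seq-shift-suc T w v (evens-one D) even≡) (cong (λ e → shift e v) (+-comm (4 * D) 1))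
    go : ∀ D → seq T (shift (2 * D) w) ≡ shift (4 * D) v × seq T (shift (1 + 2 * D) w) ≡ shift (1 + 4 * D) v
    go zero    = even₀ , odd 0 even₀
      where even₀ = trans (cong (seq T) (shift-identity w)) (sym (shift-identity v))
    go (suc D) = even′ , odd (suc D) even′
      where
      even′ : seq T (shift (2 * suc D) w) ≡ shift (4 * suc D) v
      even′ = begin
        seq T (shift (2 * suc D) w)      ≡⟨ cong (λ e → seq T (shift e w)) (*-suc 2 D) ⟩
        seq T (shift (suc (1 + 2 * D)) w) ≡⟨ seq-shift-suc T w v (odds-three D) (proj₂ (go D)) ⟩
        shift (1 + 4 * D + 3) v          ≡⟨ cong (λ e → shift e v) 1+4D+3≡4[1+D] ⟩
        shift (4 * suc D) v              ∎
        where
        open ≡-Reasoning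
        1+4D+3≡4[1+D] : 1 + 4 * D + 3 ≡ 4 * suc D
        1+4D+3≡4[1+D] = solve (D List.∷ List.[])

  alternating⇒even-length : ∀ K → suc n ≢ 1 + 2 * K
  alternating⇒even-length K N≡1+2K = 1≢3 (begin
    1                               ≡⟨ evens-one 0 ⟨
    step T (shift 0 w)              ≡⟨ cong (step T) (shift-mod 0 1 w (trans (+-identityʳ _) (trans (sym N≡1+2K) (sym (+-identityʳ _))))) ⟨
    step T (shift (1 + 2 * K) w)    ≡⟨ odds-three K ⟩
    3                               ∎)
    where
    open ≡-Reasoning
    1≢3 : 1 ≢ 3
    1≢3 ()

  alternating⇒4∤length : ¬ 4 ∣ suc n
  alternating⇒4∤length (divides zero ())
  alternating⇒4∤length (divides m@(suc _) N≡m*4) =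
    seq-shift-≢ T w 0<2m 2m<N (begin
      seq T (shift (2 * m) w)   ≡⟨ proj₁ (seq-shift-alternating m) ⟩
      shift (4 * m) v           ≡⟨ shift-mod 0 1 v (trans (+-identityʳ _) (trans (*-comm 4 m) (trans (sym N≡m*4) (sym (+-identityʳ _))))) ⟩
      shift 0 v                 ≡⟨ shift-identity v ⟩
      v                         ∎)
    where
    open ≡-Reasoning
    v = seq T w
    0<2m : 0 < 2 * m
    0<2m = s≤s z≤n
    twice+twice≡*4 : ∀ k → 2 * k + 2 * k ≡ k * 4
    twice+twice≡*4 = solve-∀
    2m<N : 2 * m < suc n
    2m<N = subst (2 * m <_) (trans (twice+twice≡*4 m) (sym N≡m*4)) (m<m+n (2 * m) 0<2m)

module OneThreeSteps {n : ℕ} (T : CyclicOrder (suc n)) (2≤n : 2 ≤ n)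
                     (one-or-three : ∀ i → step T i ≡ 1 ⊎ step T i ≡ 3) where

  private
    t = seq T
    s = step T

    step-one≢three : ∀ {i} → s i ≡ 1 → s i ≢ 3
    step-one≢three s≡1 s≡3 with trans (sym s≡1) s≡3
    ... | ()

    shift-two≢ : ∀ (x : Fin (suc n)) → shift 2 x ≢ x
    shift-two≢ x 2+x≡x with shift-injectiveˡ x (s≤s 2≤n) (s≤s z≤n) (trans 2+x≡x (sym (shift-identity x)))
    ... | ()

  step-three-+2 : ∀ {i j} → s i ≡ 3 → t j ≡ shift 2 (t i) → s j ≡ 3
  step-three-+2 {i} {j} sᵢ≡3 tⱼ≡tᵢ+2 with one-or-three j
  ... | inj₂ sⱼ≡3 = sⱼ≡3
  ... | inj₁ sⱼ≡1 = ⊥-elim (shift-two≢ (t i) (trans (sym tⱼ≡tᵢ+2) (cong t j≡i)))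
    where
    open ≡-Reasoning
    j≡i : j ≡ i
    j≡i = next-injective (inj T (begin
      t (next j)              ≡⟨ seq-next T j ⟩
      shift (s j) (t j)       ≡⟨ cong (λ c → shift c (t j)) sⱼ≡1 ⟩
      shift 1 (t j)           ≡⟨ cong (shift 1) tⱼ≡tᵢ+2 ⟩
      shift 1 (shift 2 (t i)) ≡⟨ shift-+ 1 2 (t i) ⟩
      shift 3 (t i)           ≡⟨ cong (λ c → shift c (t i)) sᵢ≡3 ⟨
      shift (s i) (t i)       ≡⟨ seq-next T i ⟨
      t (next i)              ∎))

  step-three-−2 : ∀ {i j} → s j ≡ 3 → t j ≡ shift 2 (t i) → s i ≡ 3
  step-three-−2 {i} {j} sⱼ≡3 tⱼ≡tᵢ+2 with injective⇒surjective (λ e → next-injective (inj T e)) (shift 3 (t i))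
  ... | p , tₚ₊₁≡tᵢ+3 with one-or-three p
  ...   | inj₂ sₚ≡3 = subst (λ k → s k ≡ 3) p≡i sₚ≡3
    where
    open ≡-Reasoning
    p≡i : p ≡ i
    p≡i = inj T (shift-injective 3 (begin
      shift 3 (t p)      ≡⟨ cong (λ c → shift c (t p)) sₚ≡3 ⟨
      shift (s p) (t p)  ≡⟨ seq-next T p ⟨
      t (next p)         ≡⟨ tₚ₊₁≡tᵢ+3 ⟩
      shift 3 (t i)      ∎))
  ...   | inj₁ sₚ≡1 = ⊥-elim (step-one≢three (subst (λ k → s k ≡ 1) p≡j sₚ≡1) sⱼ≡3)
    where
    open ≡-Reasoning
    p≡j : p ≡ j
    p≡j = inj T (shift-injective 1 (begin
      shift 1 (t p)            ≡⟨ cong (λ c → shift c (t p)) sₚ≡1 ⟨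
      shift (s p) (t p)        ≡⟨ seq-next T p ⟨
      t (next p)               ≡⟨ tₚ₊₁≡tᵢ+3 ⟩
      shift 3 (t i)            ≡⟨ shift-+ 1 2 (t i) ⟨
      shift 1 (shift 2 (t i))  ≡⟨ cong (shift 1) tⱼ≡tᵢ+2 ⟨
      shift 1 (t j)            ∎))

  step-+2 : ∀ {i j} → t j ≡ shift 2 (t i) → s j ≡ s i
  step-+2 {i} {j} tⱼ≡tᵢ+2 with one-or-three i | one-or-three j
  ... | inj₁ sᵢ≡1 | inj₁ sⱼ≡1 = trans sⱼ≡1 (sym sᵢ≡1)
  ... | inj₂ sᵢ≡3 | inj₂ sⱼ≡3 = trans sⱼ≡3 (sym sᵢ≡3)
  ... | inj₂ sᵢ≡3 | inj₁ sⱼ≡1 = ⊥-elim (step-one≢three sⱼ≡1 (step-three-+2 sᵢ≡3 tⱼ≡tᵢ+2))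
  ... | inj₁ sᵢ≡1 | inj₂ sⱼ≡3 = ⊥-elim (step-one≢three sᵢ≡1 (step-three-−2 sⱼ≡3 tⱼ≡tᵢ+2))

  step-+2* : ∀ m {i j} → t j ≡ shift (2 * m) (t i) → s j ≡ s i
  step-+2* zero    {i} {j} tⱼ≡tᵢ = cong s (inj T (trans tⱼ≡tᵢ (shift-identity (t i))))
  step-+2* (suc m) {i} {j} tⱼ≡tᵢ+2m+2 with injective⇒surjective (inj T) (shift (2 * m) (t i))
  ... | k , tₖ≡tᵢ+2m = trans (step-+2 tⱼ≡tₖ+2) (step-+2* m tₖ≡tᵢ+2m)
    where
    tⱼ≡tₖ+2 : t j ≡ shift 2 (t k)
    tⱼ≡tₖ+2 = begin
      t j                          ≡⟨ tⱼ≡tᵢ+2m+2 ⟩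
      shift (2 * suc m) (t i)      ≡⟨ cong (λ c → shift c (t i)) (trans (*-suc 2 m) (+-comm 2 (2 * m))) ⟩
      shift (2 * m + 2) (t i)      ≡⟨ shift-+ 2 (2 * m) (t i) ⟨
      shift 2 (shift (2 * m) (t i)) ≡⟨ cong (shift 2) tₖ≡tᵢ+2m ⟨
      shift 2 (t k)                ∎
      where open ≡-Reasoning

  two-steps-even : ∀ i j → Σ ℕ λ m → s i + s j ≡ 2 * m
  two-steps-even i j with one-or-three i | one-or-three j
  ... | inj₁ sᵢ≡1 | inj₁ sⱼ≡1 = 1 , cong₂ _+_ sᵢ≡1 sⱼ≡1
  ... | inj₁ sᵢ≡1 | inj₂ sⱼ≡3 = 2 , cong₂ _+_ sᵢ≡1 sⱼ≡3
  ... | inj₂ sᵢ≡3 | inj₁ sⱼ≡1 = 2 , cong₂ _+_ sᵢ≡3 sⱼ≡1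
  ... | inj₂ sᵢ≡3 | inj₂ sⱼ≡3 = 3 , cong₂ _+_ sᵢ≡3 sⱼ≡3

  step-next-next : ∀ i → s (next (next i)) ≡ s i
  step-next-next i with two-steps-even i (next i)
  ... | m , sᵢ+sᵢ₊₁≡2m = step-+2* m (begin
    t (next (next i))                       ≡⟨ seq-next T (next i) ⟩
    shift (s (next i)) (t (next i))         ≡⟨ cong (shift (s (next i))) (seq-next T i) ⟩
    shift (s (next i)) (shift (s i) (t i))  ≡⟨ shift-+ (s (next i)) (s i) (t i) ⟩
    shift (s i + s (next i)) (t i)          ≡⟨ cong (λ c → shift c (t i)) sᵢ+sᵢ₊₁≡2m ⟩
    shift (2 * m) (t i)                     ∎)
    where open ≡-Reasoning

  step-shift-+2 : ∀ d x → s (shift (2 + d) x) ≡ s (shift d x)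
  step-shift-+2 d x = trans (cong s (trans (shift-suc (suc d) x) (cong next (shift-suc d x)))) (step-next-next (shift d x))

  step-shift-even : ∀ D x → s (shift (2 * D) x) ≡ s x
  step-shift-even zero    x = cong s (shift-identity x)
  step-shift-even (suc D) x =
    trans (cong (λ e → s (shift e x)) (*-suc 2 D)) (trans (step-shift-+2 (2 * D) x) (step-shift-even D x))

  step-shift-odd : ∀ D x → s (shift (1 + 2 * D) x) ≡ s (next x)
  step-shift-odd D x =
    trans (cong s (sym (shift-+ (2 * D) 1 x))) (trans (step-shift-even D (shift 1 x)) (cong s (sym (next-shift x))))

  data StepPattern : Set where
    all-one     : (∀ i → s i ≡ 1) → StepPattern
    all-three   : ∀ z → (∀ d → s (shift d z) ≡ 3) → StepPattern
    alternating : ∀ w → (∀ D → s (shift (2 * D) w) ≡ 1) → (∀ D → s (shift (1 + 2 * D) w) ≡ 3) → StepPattern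

  step-pattern : StepPattern
  step-pattern with all? (λ i → s i ≟ 1)
  ... | yes steps-one = all-one steps-one
  ... | no ¬steps-one with ¬∀⟶∃¬ (suc n) (λ i → s i ≡ 1) (λ i → s i ≟ 1) ¬steps-one
  ... | z , sz≢1 with one-or-three z | one-or-three (next z)
  ...   | inj₁ sz≡1 | _           = ⊥-elim (sz≢1 sz≡1)
  ...   | inj₂ sz≡3 | inj₂ sz′≡3 = all-three z threes
    where
    threes : ∀ d → s (shift d z) ≡ 3
    threes zero          = trans (cong s (shift-identity z)) sz≡3
    threes (suc zero)    = trans (cong s (sym (next-shift z))) sz′≡3
    threes (suc (suc d)) = trans (step-shift-+2 d z) (threes d)
  ...   | inj₂ sz≡3 | inj₁ sz′≡1 = alternating (next z)
    (λ D → trans (step-shift-even D (next z)) sz′≡1)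
    (λ D → trans (step-shift-odd D (next z)) (trans (step-next-next z) sz≡3))

affine-< : ∀ q a b c d {a<c : True (a <? c)} {b≤d : True (b ≤? d)} → a + q * b < c + q * d
affine-< q a b c d {a<c} {b≤d} = +-mono-<-≤ (toWitness a<c) (*-monoʳ-≤ q (toWitness b≤d))

numeral-< : ∀ q a c d {a<c : True (a <? c)} → a < c + q * d
numeral-< q a c d {a<c} = <-≤-trans (toWitness a<c) (m≤m+n c (q * d))

-- With v = t z, position z + o carries v + 3 o; the offsets 0, 1, 3 + q, 5 + 2 q carry
-- v, v + 3, v + 2, v + 1, which the standard order visits as v + 2, v + 3, v, v + 1.
four-interlaced-7+3q : ∀ q (T : CyclicOrder (7 + q * 3)) z → (∀ d → step T (shift d z) ≡ 3) →
                       FourInterlaced (standard (7 + q * 3)) T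
four-interlaced-7+3q q T z threes =
  a , b , c , d , shifts-distinct x S-offsets S-ascending , restricts-shifts (standard N) x 0 _ S-ascending ,
  subst (Restricts T) T-order (restricts-shifts T z 0 _ T-ascending)
  where
  N = 7 + q * 3
  v = seq T z
  x = shift 2 v
  S-offsets = 0 ∷ 1 ∷ 5 + q * 3 ∷ 6 + q * 3 ∷ []
  a = shift 0 x
  b = shift 1 x
  c = shift (5 + q * 3) x
  d = shift (6 + q * 3) x
  S-ascending : Linked _<_ (S-offsets ++ [ N ])
  S-ascending = s≤s z≤n ∷ numeral-< q 1 5 3 ∷ affine-< q 5 3 6 3 ∷ affine-< q 6 3 7 3 ∷ [-]
  T-ascending : Linked _<_ (0 ∷ 1 ∷ 3 + q * 1 ∷ 5 + q * 2 ∷ [ N ])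
  T-ascending = s≤s z≤n ∷ numeral-< q 1 3 1 ∷ affine-< q 3 1 5 2 ∷ affine-< q 5 2 7 3 ∷ [-]
  value : ∀ o p k l → o * 3 + k * (7 + q * 3) ≡ 2 + p + l * (7 + q * 3) → seq T (shift o z) ≡ shift p x
  value o p k l eq = trans (seq-shift-constant T z threes o) (trans (shift-mod k l v eq) (sym (shift-+ p 2 v)))
  T-order : map (λ e → seq T (shift e z)) (0 ∷ 1 ∷ 3 + q * 1 ∷ 5 + q * 2 ∷ []) ≡ c ∷ b ∷ a ∷ d ∷ []
  T-order = Pointwise-≡⇒≡
    ( value 0           (5 + q * 3) 1 0 (solve (q List.∷ List.[]))
    ∷ value 1           1           0 0 refl
    ∷ value (3 + q * 1) 0           0 1 (solve (q List.∷ List.[]))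
    ∷ value (5 + q * 2) (6 + q * 3) 0 1 (solve (q List.∷ List.[]))
    ∷ [])

-- The offsets 0, 2, 4 + q, 6 + 2 q carry v, v + 6, v + 4, v + 2.
four-interlaced-8+3q : ∀ q (T : CyclicOrder (8 + q * 3)) z → (∀ d → step T (shift d z) ≡ 3) →
                       FourInterlaced (standard (8 + q * 3)) T
four-interlaced-8+3q q T z threes =
  a , b , c , d , shifts-distinct x S-offsets S-ascending , restricts-shifts (standard N) x 0 _ S-ascending ,
  subst (Restricts T) T-order (restricts-shifts T z 0 _ T-ascending)
  where
  N = 8 + q * 3
  v = seq T z
  x = shift 4 v
  S-offsets = 0 ∷ 2 ∷ 4 + q * 3 ∷ 6 + q * 3 ∷ []
  a = shift 0 x
  b = shift 2 x
  c = shift (4 + q * 3) x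
  d = shift (6 + q * 3) x
  S-ascending : Linked _<_ (S-offsets ++ [ N ])
  S-ascending = s≤s z≤n ∷ numeral-< q 2 4 3 ∷ affine-< q 4 3 6 3 ∷ affine-< q 6 3 8 3 ∷ [-]
  T-ascending : Linked _<_ (0 ∷ 2 ∷ 4 + q * 1 ∷ 6 + q * 2 ∷ [ N ])
  T-ascending = s≤s z≤n ∷ numeral-< q 2 4 1 ∷ affine-< q 4 1 6 2 ∷ affine-< q 6 2 8 3 ∷ [-]
  value : ∀ o p k l → o * 3 + k * (8 + q * 3) ≡ 4 + p + l * (8 + q * 3) → seq T (shift o z) ≡ shift p x
  value o p k l eq = trans (seq-shift-constant T z threes o) (trans (shift-mod k l v eq) (sym (shift-+ p 4 v)))
  T-order : map (λ e → seq T (shift e z)) (0 ∷ 2 ∷ 4 + q * 1 ∷ 6 + q * 2 ∷ []) ≡ c ∷ b ∷ a ∷ d ∷ []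
  T-order = Pointwise-≡⇒≡
    ( value 0           (4 + q * 3) 1 0 (solve (q List.∷ List.[]))
    ∷ value 2           2           0 0 refl
    ∷ value (4 + q * 1) 0           0 1 (solve (q List.∷ List.[]))
    ∷ value (6 + q * 2) (6 + q * 3) 0 1 (solve (q List.∷ List.[]))
    ∷ [])

-- With v = t w, position w + 2 D carries v + 4 D and w + 1 + 2 D carries v + 1 + 4 D, so from
-- w′ = w + 6 + 2 q the offsets 0, 1, 4 + 2 q, 5 + 2 q, 6 + 2 q, 7 + 2 q carry v + 2, v + 3, v, v + 1, v + 4, v + 5.
six-interlaced-10+4q : ∀ q (T : CyclicOrder (10 + q * 4)) w →
                       (∀ D → step T (shift (2 * D) w) ≡ 1) → (∀ D → step T (shift (1 + 2 * D) w) ≡ 3) →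
                       SixInterlaced (standard (10 + q * 4)) T
six-interlaced-10+4q q T w evens-one odds-three =
  a , b , c , d , e , f , shifts-distinct v S-offsets S-ascending , restricts-shifts (standard N) v 0 _ S-ascending ,
  inj₁ (subst (Restricts T) T-order (restricts-shifts T w′ 0 _ T-ascending))
  where
  N = 10 + q * 4
  v = seq T w
  S-offsets = 0 ∷ 1 ∷ 2 ∷ 3 ∷ 4 ∷ 5 ∷ []
  a = shift 0 v
  b = shift 1 v
  c = shift 2 v
  d = shift 3 v
  e = shift 4 v
  f = shift 5 v
  S-ascending : Linked _<_ (S-offsets ++ [ N ])
  S-ascending = n<1+n 0 ∷ n<1+n 1 ∷ n<1+n 2 ∷ n<1+n 3 ∷ n<1+n 4 ∷ numeral-< q 5 10 4 ∷ [-]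
  w′ = shift (6 + q * 2) w
  T-ascending : Linked _<_ (0 ∷ 1 ∷ 4 + q * 2 ∷ 5 + q * 2 ∷ 6 + q * 2 ∷ 7 + q * 2 ∷ [ N ])
  T-ascending = n<1+n 0 ∷ numeral-< q 1 4 2 ∷ affine-< q 4 2 5 2 ∷ affine-< q 5 2 6 2 ∷ affine-< q 6 2 7 2 ∷ affine-< q 7 2 10 4 ∷ [-]
  values = seq-shift-alternating T w evens-one odds-three
  even-value : ∀ o D j k l → 6 + q * 2 + o ≡ 2 * D → 4 * D + k * (10 + q * 4) ≡ j + l * (10 + q * 4) →
               seq T (shift o w′) ≡ shift j v
  even-value o D j k l o≡2D eq = begin
    seq T (shift o w′)               ≡⟨ cong (seq T) (shift-+ o (6 + q * 2) w) ⟩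
    seq T (shift (6 + q * 2 + o) w)  ≡⟨ cong (λ m → seq T (shift m w)) o≡2D ⟩
    seq T (shift (2 * D) w)          ≡⟨ proj₁ (values D) ⟩
    shift (4 * D) v                  ≡⟨ shift-mod k l v eq ⟩
    shift j v                        ∎
    where open ≡-Reasoning
  odd-value : ∀ o D j k l → 6 + q * 2 + o ≡ 1 + 2 * D → 1 + 4 * D + k * (10 + q * 4) ≡ j + l * (10 + q * 4) →
              seq T (shift o w′) ≡ shift j v
  odd-value o D j k l o≡1+2D eq = begin
    seq T (shift o w′)               ≡⟨ cong (seq T) (shift-+ o (6 + q * 2) w) ⟩
    seq T (shift (6 + q * 2 + o) w)  ≡⟨ cong (λ m → seq T (shift m w)) o≡1+2D ⟩
    seq T (shift (1 + 2 * D) w)      ≡⟨ proj₂ (values D) ⟩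
    shift (1 + 4 * D) v              ≡⟨ shift-mod k l v eq ⟩
    shift j v                        ∎
    where open ≡-Reasoning
  T-order : map (λ o → seq T (shift o w′)) (0 ∷ 1 ∷ 4 + q * 2 ∷ 5 + q * 2 ∷ 6 + q * 2 ∷ 7 + q * 2 ∷ [])
            ≡ c ∷ d ∷ a ∷ b ∷ e ∷ f ∷ []
  T-order = Pointwise-≡⇒≡
    ( even-value 0           (3 + q * 1) 2 0 1 (solve (q List.∷ List.[])) (solve (q List.∷ List.[]))
    ∷ odd-value  1           (3 + q * 1) 3 0 1 (solve (q List.∷ List.[])) (solve (q List.∷ List.[]))
    ∷ even-value (4 + q * 2) (5 + q * 2) 0 0 2 (solve (q List.∷ List.[])) (solve (q List.∷ List.[]))
    ∷ odd-value  (5 + q * 2) (5 + q * 2) 1 0 2 (solve (q List.∷ List.[])) (solve (q List.∷ List.[]))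
    ∷ even-value (6 + q * 2) (6 + q * 2) 4 0 2 (solve (q List.∷ List.[])) (solve (q List.∷ List.[]))
    ∷ odd-value  (7 + q * 2) (6 + q * 2) 5 0 2 (solve (q List.∷ List.[])) (solve (q List.∷ List.[]))
    ∷ [])

≥-divMod : ∀ b d .{{_ : NonZero d}} {m} → b ≤ m → Σ ℕ λ q → Σ (Fin d) λ r → m ≡ b + (toℕ r + q * d)
≥-divMod b d {m} b≤m with (m ∸ b) divMod d
... | result q r m∸b≡r+q*d = q , r , trans (sym (m+[n∸m]≡n b≤m)) (cong (b +_) m∸b≡r+q*d)

threes⇒four-interlaced : ∀ {n} → 7 ≤ suc n → ∀ (T : CyclicOrder (suc n)) z → (∀ d → step T (shift d z) ≡ 3) →
                         FourInterlaced (standard (suc n)) T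
threes⇒four-interlaced 7≤N T z threes with ≥-divMod 7 3 7≤N
... | q , zero , refl             = four-interlaced-7+3q q T z threes
... | q , suc zero , refl         = four-interlaced-8+3q q T z threes
... | q , suc (suc zero) , refl   = ⊥-elim (constant-step⇒∤ T z (s≤s (s≤s z≤n)) threes (divides (3 + q) (solve (q List.∷ List.[]))))

alternating⇒six-interlaced : ∀ {n} → 7 ≤ suc n → ∀ (T : CyclicOrder (suc n)) w →
                             (∀ D → step T (shift (2 * D) w) ≡ 1) → (∀ D → step T (shift (1 + 2 * D) w) ≡ 3) →
                             SixInterlaced (standard (suc n)) T
alternating⇒six-interlaced 7≤N T w evens-one odds-three with ≥-divMod 7 4 7≤N
... | q , zero , refl                 = ⊥-elim (alternating⇒even-length T w evens-one odds-three (3 + q * 2) (solve (q List.∷ List.[])))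
... | q , suc zero , refl             = ⊥-elim (alternating⇒4∤length T w evens-one odds-three (divides (2 + q) (solve (q List.∷ List.[]))))
... | q , suc (suc zero) , refl       = ⊥-elim (alternating⇒even-length T w evens-one odds-three (4 + q * 2) (solve (q List.∷ List.[])))
... | q , suc (suc (suc zero)) , refl = six-interlaced-10+4q q T w evens-one odds-three

open OneThreeSteps using (step-pattern; all-one; all-three; alternating)

corollary5p10 : (n : ℕ) → 7 ≤ n → (T : CyclicOrder n) →
    ¬ (standard n ≈c T) →
    (∀ (i : Fin n) → step T i ≡ 1 ⊎ step T i ≡ 3) →
    FourInterlaced (standard n) T ⊎ SixInterlaced (standard n) T
corollary5p10 (suc n) 7≤N@(s≤s 6≤n) T T≉standard one-or-three
  with step-pattern T (≤-trans (s≤s (s≤s z≤n)) 6≤n) one-or-three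
... | all-one steps-one                 = ⊥-elim (T≉standard (steps-one⇒≈standard T steps-one))
... | all-three z threes                = inj₁ (threes⇒four-interlaced 7≤N T z threes)
... | alternating w evens-one odds-three = inj₂ (alternating⇒six-interlaced 7≤N T w evens-one odds-three)
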